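{- Let $D$ be a digraph with potential function $\phi$, let $S_{min}$ be an inclusion-wise minimal feasible solution for $(D,\phi)$, and let $Z_{min}$ be the set of sinks of $D-S_{min}$. Let $x\in Z_{min}$ and let $(D',\phi')=update(D,\phi,x,-)$. Then $S_{min}=N^+(x)\cup S'$ for some inclusion-wise minimal feasible solution $S'$ of $(D',\phi')$. Moreover, if $S'_{min}$ is any inclusion-wise minimal feasible solution of $(D',\phi')$, then $N^+(x)\cup S'_{min}$ is a feasible solution of $(D,\phi)$.
   Context: All digraphs are finite, without loops or parallel arcs; $N^+(v)$ and $N^-(v)$ denote out- and in-neighbourhoods in $D$. A sink is a vertex of out-degree $0$. A knot in a digraph is a strongly connected component of size at least $2$ with no arc leaving it; a digraph is knot-free if it has no knot. A potential function is a map $\phi:V(D)\to\{0.25,1\}$; vertices with $\phi(v)=1$ are undecided, their set is $\mathcal{U}$. A set $S\subseteq V(D)$ is a feasible solution for $(D,\phi)$ if $D-S$ (the subgraph induced on $V(D)\setminus S$) is knot-free and every sink $s$ of $D-S$ satisfies $\phi(s)=1$. For $v\in V(D)$, $R^-(v)$ is the set of vertices having a directed path to $v$ in $D-N^+(v)$ (so $v\in R^-(v)$), $R(v)=N^+(v)\cup R^-(v)$, and $R^+(v)=\{u\in\mathcal{U}: v\in R^-(u)\}$. For a vertex $s$, $update(D,\phi,s,-)$ returns $(D',\phi')$ where $D'=D-R(s)$ and $\phi'$ is defined on $V(D')$ by $\phi'(v)=0.25$ if $v\in R^+(s)$ and $\phi'(v)=\phi(v)$ otherwise. -}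

module Defs where

open import Level using (0ℓ)
open import Data.Nat using (ℕ)
open import Data.Fin using (Fin)
open import Data.Fin.Subset using (Subset; _∈_; _⊆_)
open import Data.Product using (Σ; _×_; ∃; ∃-syntax; _,_)
open import Data.Sum using (_⊎_)
open import Data.Empty using (⊥)
open import Relation.Nullary using (¬_)
open import Relation.Unary using (Pred)
open import Relation.Binary.PropositionalEquality using (_≡_; _≢_)
open import Relation.Binary.Construct.Closure.ReflexiveTransitive using (Star)

record Digraph : Set₁ where
  field
    n     : ℕ
    Arc   : Fin n → Fin n → Set
    arc?  : ∀ u v → Relation.Nullary.Dec (Arc u v)
    loopless : ∀ v → ¬ Arc v v
open Digraph public

-- vertex sets of (induced) subdigraphs are predicates on Fin n
VSet : ℕ → Set₁
VSet n = Pred (Fin n) 0ℓ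

data Pot : Set where
  quarter one : Pot

_∖_ : ∀ {n} → VSet n → VSet n → VSet n
(W ∖ S) v = W v × ¬ S v

module _ (D : Digraph) where
  private
    V = Fin (n D)
    E = Arc D

  N⁺ : V → VSet (n D)
  N⁺ v u = E v u

  StepIn : VSet (n D) → V → V → Set
  StepIn W a b = W a × W b × E a b

  PathIn : VSet (n D) → V → V → Set
  PathIn W u v = W u × Star (StepIn W) u v

  SinkIn : VSet (n D) → V → Set
  SinkIn W v = W v × (∀ u → W u → ¬ E v u)

  record KnotIn (W : VSet (n D)) (K : VSet (n D)) : Set where
    field
      sub       : ∀ v → K v → W v
      two       : Σ V λ a → Σ V λ b → K a × K b × a ≢ b
      strong    : ∀ a b → K a → K b → PathIn W a b
      maximal   : ∀ a b → K a → W b → PathIn W a b → PathIn W b a → K b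
      noLeaving : ∀ a b → K a → W b → E a b → K b

  KnotFreeIn : VSet (n D) → Set₁
  KnotFreeIn W = ∀ K → ¬ KnotIn W K

  -- S is a feasible solution for (D[W], φ), where the potential is given by its set
  -- U of undecided vertices (φ(v) = 1 iff U v).
  Feasible : VSet (n D) → VSet (n D) → VSet (n D) → Set₁
  Feasible W U S =
    (∀ v → S v → W v) ×
    KnotFreeIn (W ∖ S) ×
    (∀ s → SinkIn (W ∖ S) s → U s)

  MinFeasible : VSet (n D) → VSet (n D) → Subset (n D) → Set₁
  MinFeasible W U S =
    Feasible W U (_∈ S) ×
    (∀ (T : Subset (n D)) → Feasible W U (_∈ T) → T ⊆ S → S ⊆ T)

  R⁻ : VSet (n D) → V → VSet (n D)
  R⁻ W v u = PathIn (W ∖ N⁺ v) u v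

  R : VSet (n D) → V → VSet (n D)
  R W v u = (W u × N⁺ v u) ⊎ R⁻ W v u

  R⁺ : VSet (n D) → VSet (n D) → V → VSet (n D)
  R⁺ W U v u = U u × R⁻ W u v

  -- update(D[W], U, s, -): new vertex set W ∖ R(s), new undecided set
  -- U' = { v : φ(v) = 1 and v ∉ R⁺(s) } (restricted to the new vertex set).
  updateV : VSet (n D) → V → VSet (n D)
  updateV W s = W ∖ R W s

  updateU : VSet (n D) → VSet (n D) → V → VSet (n D)
  updateU W U s v = updateV W s v × U v × ¬ R⁺ W U s v

Full : ∀ {n} → VSet n
Full _ = Data.Unit.⊤
  where import Data.Unit

Undecided : ∀ {n} → (Fin n → Pot) → VSet n
Undecided φ v = φ v ≡ one

{-# OPTIONS --safe #-}
-- The sink x has no out-arc into X, so a knot of a graph containing R⁻(x)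
-- cannot meet R⁻(x) (it would contain x), and a sink in R⁻(x) can only be x itself; hence adding
-- or removing R⁻(x) preserves feasibility, and minimality forces Smin ∩ R⁻(x) = ∅. So Smin ∖ N⁺(x)
-- lies in D' = D − R(x), and D' − (Smin ∖ N⁺(x)) is a subgraph of D − Smin closed under out-arcs,
-- which inherits knot-freeness and sinks. Conversely N⁺(x) ∪ S' is feasible for D whenever S' is
-- feasible for D', which transfers minimality between the two problems.
module Submission where

open import Defs
open import Data.Fin using (Fin)
open import Data.Fin.Subset using (Subset; _∈_)
open import Data.Product using (Σ; _×_; _,_)
open import Data.Sum using (_⊎_)
open import Function.Bundles using (_⇔_)

open import Data.Nat using (zero; suc)
open import Data.Fin using (zero; suc)
open import Data.Fin.Subset using (_⊆_)
open import Data.Fin.Subset.Properties using (_∈?_)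
open import Data.Vec using (tabulate)
open import Data.Vec.Properties using ([]=⇒lookup; lookup⇒[]=; lookup∘tabulate)
open import Data.Product using (proj₁; proj₂; swap)
open import Data.Sum using (inj₁; inj₂; [_,_]′; map₂)
open import Data.Empty using (⊥-elim)
open import Data.Unit using (tt)
open import Effect.Monad using (RawMonad)
open import Function using (_∘_; id)
open import Function.Bundles using (mk⇔)
open import Relation.Binary.PropositionalEquality using (_≡_; refl; sym; trans; subst)
open import Relation.Binary.Construct.Closure.ReflexiveTransitive using (Star; ε; _◅_; map)
open import Relation.Nullary using (¬_; Dec; yes; no; does)
open import Relation.Nullary.Decidable using (_×-dec_; _⊎-dec_; ¬?; dec-true; decidable-stable; ¬¬-excluded-middle; toSum)
open import Relation.Nullary.Negation using (¬¬-Monad; ¬¬-map)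
open import Relation.Unary using (Decidable; Stable; _⊆′_; _≐′_; _∪_)

subset : ∀ {m} {P : VSet m} → Decidable P → Subset m
subset P? = tabulate (does ∘ P?)

∈-subset : ∀ {m} {P : VSet m} (P? : Decidable P) → (_∈ subset P?) ≐′ P
∈-subset {P = P} P? = to , from
  where
  to : (_∈ subset P?) ⊆′ P
  to v v∈ with P? v | trans (sym (lookup∘tabulate (does ∘ P?) v)) ([]=⇒lookup v∈)
  ... | yes p | _ = p
  ... | no _  | ()
  from : P ⊆′ (_∈ subset P?)
  from v p = lookup⇒[]= v _ (trans (lookup∘tabulate (does ∘ P?) v) (dec-true (P? v) p))

¬¬-decidable : ∀ {m} (P : VSet m) → ¬ ¬ Decidable P
¬¬-decidable {zero}  P k = k λ ()
¬¬-decidable {suc m} P = do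
  P₀? ← ¬¬-excluded-middle
  P₊? ← ¬¬-decidable (P ∘ suc)
  pure λ { zero → P₀? ; (suc v) → P₊? v }
  where open RawMonad ¬¬-Monad

undecided? : ∀ {m} (φ : Fin m → Pot) → Decidable (Undecided φ)
undecided? φ v with φ v
... | one     = yes refl
... | quarter = no λ ()

module _ (D : Digraph) where
  private
    V = Fin (n D)
    VS = VSet (n D)
    variable
      W W₀ W₁ W₂ X K U : VS
      a b s z : V

  NoArcInto : VS → V → Set
  NoArcInto W z = ∀ c → W c → ¬ Arc D z c

  OutClosed : VS → VS → Set
  OutClosed W₁ W₂ = ∀ a b → W₁ a → W₂ b → Arc D a b → W₁ b

  Admissible : VS → VS → Set₁
  Admissible W U = KnotFreeIn D W × (∀ s → SinkIn D W s → U s)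

  path-mono : W₁ ⊆′ W₂ → Star (StepIn D W₁) a b → Star (StepIn D W₂) a b
  path-mono W₁⊆W₂ = map λ (wa , wb , e) → W₁⊆W₂ _ wa , W₁⊆W₂ _ wb , e

  pathIn-mono : W₁ ⊆′ W₂ → PathIn D W₁ a b → PathIn D W₂ a b
  pathIn-mono W₁⊆W₂ (wa , p) = W₁⊆W₂ _ wa , path-mono W₁⊆W₂ p

  path-closed : OutClosed W₁ W₂ → W₁ a → Star (StepIn D W₂) a b → W₁ b × Star (StepIn D W₁) a b
  path-closed closed wa ε = wa , ε
  path-closed closed wa ((_ , wb , e) ◅ p) =
    let wb₁ = closed _ _ wa wb e
        (wc , p₁) = path-closed closed wb₁ p
    in wc , (wa , wb₁ , e) ◅ p₁

  knot-path : KnotIn D W K → K a → Star (StepIn D W) a b → K b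
  knot-path κ ka p = proj₁ (path-closed (KnotIn.noLeaving κ) ka p)

  knot-singleton : KnotIn D W K → K z → NoArcInto W z → ∀ w → K w → z ≡ w
  knot-singleton κ kz silent w kw with proj₂ (KnotIn.strong κ _ w kz kw)
  ... | ε                = refl
  ... | (_ , wc , e) ◅ _ = ⊥-elim (silent _ wc e)

  knot-¬NoArcInto : KnotIn D W K → K z → ¬ NoArcInto W z
  knot-¬NoArcInto κ kz silent =
    let (a , b , ka , kb , a≢b) = KnotIn.two κ
    in a≢b (trans (sym (knot-singleton κ kz silent a ka)) (knot-singleton κ kz silent b kb))

  knot-restrict : W₁ ⊆′ W₂ → K ⊆′ W₁ → KnotIn D W₂ K → KnotIn D W₁ K
  knot-restrict W₁⊆W₂ K⊆W₁ κ = record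
    { sub       = K⊆W₁
    ; two       = two
    ; strong    = λ a b ka kb →
        pathIn-mono K⊆W₁ (ka , proj₂ (path-closed noLeaving ka (proj₂ (strong a b ka kb))))
    ; maximal   = λ a b ka wb p q →
        maximal a b ka (W₁⊆W₂ b wb) (pathIn-mono W₁⊆W₂ p) (pathIn-mono W₁⊆W₂ q)
    ; noLeaving = λ a b ka wb → noLeaving a b ka (W₁⊆W₂ b wb)
    }
    where open KnotIn κ

  knot-extend : W₁ ⊆′ W₂ → OutClosed W₁ W₂ → KnotIn D W₁ K → KnotIn D W₂ K
  knot-extend W₁⊆W₂ closed κ = record
    { sub       = λ v kv → W₁⊆W₂ v (sub v kv)
    ; two       = two
    ; strong    = λ a b ka kb → pathIn-mono W₁⊆W₂ (strong a b ka kb)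
    ; maximal   = λ a b ka wb p q →
        let (wb₁ , p₁) = path-closed closed (sub a ka) (proj₂ p)
            (_ , q₁)   = path-closed closed wb₁ (proj₂ q)
        in maximal a b ka wb₁ (sub a ka , p₁) (wb₁ , q₁)
    ; noLeaving = λ a b ka wb e → noLeaving a b ka (closed a b (sub a ka) wb e) e
    }
    where open KnotIn κ

  sink-restrict : X ⊆′ W → X s → SinkIn D W s → SinkIn D X s
  sink-restrict X⊆W xs (_ , silent) = xs , λ c xc → silent c (X⊆W c xc)

  sink-closed : W₁ ⊆′ W₂ → OutClosed W₁ W₂ → SinkIn D W₁ s → SinkIn D W₂ s
  sink-closed W₁⊆W₂ closed (ws , silent) = W₁⊆W₂ _ ws , λ c wc e → silent c (closed _ c ws wc e) e

  admissible-resp : W₁ ≐′ W₂ → Admissible W₁ U → Admissible W₂ U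
  admissible-resp (W₁⊆W₂ , W₂⊆W₁) (knotFree , sinks) =
    (λ K κ → knotFree K (knot-restrict W₁⊆W₂ (λ k kk → W₂⊆W₁ k (KnotIn.sub κ k kk)) κ)) ,
    (λ s sink → sinks s (sink-restrict W₁⊆W₂ (W₂⊆W₁ s (proj₁ sink)) sink))

  feasible-resp : ∀ {S₁ S₂ : VS} → S₁ ≐′ S₂ → Feasible D W U S₁ → Feasible D W U S₂
  feasible-resp (S₁⊆S₂ , S₂⊆S₁) (S₁⊆W , admissible) =
    (λ v → S₁⊆W v ∘ S₂⊆S₁ v) ,
    admissible-resp ((λ v (w , ∉S₁) → w , ∉S₁ ∘ S₂⊆S₁ v) , (λ v (w , ∉S₂) → w , ∉S₂ ∘ S₁⊆S₂ v))
                    admissible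

  R⁻-refl : W z → R⁻ D W z z
  R⁻-refl wz = (wz , loopless D _) , ε

  R⁻-step : W a → ¬ N⁺ D z a → Arc D a b → R⁻ D W z b → R⁻ D W z a
  R⁻-step wa a∉N⁺ e (wb , p) = (wa , a∉N⁺) , ((wa , a∉N⁺) , wb , e) ◅ p

  R⁻-path : R⁻ D W z a → Star (StepIn D (R⁻ D W z)) a z
  R⁻-path {W = W} {z = z} (wa , p) = along wa p
    where
    along : ∀ {a} → (W ∖ N⁺ D z) a → Star (StepIn D (W ∖ N⁺ D z)) a z → Star (StepIn D (R⁻ D W z)) a z
    along _  ε                      = ε
    along wa (step@(_ , wb , e) ◅ p) = ((wa , step ◅ p) , (wb , p) , e) ◅ along wb p

  sink-R⁻ : R⁻ D W₀ z ⊆′ W → SinkIn D W s → R⁻ D W₀ z s → s ≡ z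
  sink-R⁻ R⊆W (_ , silent) r with R⁻-path r
  ... | ε                = refl
  ... | (_ , rb , e) ◅ _ = ⊥-elim (silent _ (R⊆W _ rb) e)

  -- A knot meeting R⁻(z) inside W would contain z, which has no out-arc in W.
  admissible-adjoin-R⁻ : Stable U → U z → R⁻ D W₀ z ⊆′ W → NoArcInto W z →
                         X ⊆′ W → W ∖ R⁻ D W₀ z ⊆′ X → Admissible X U → Admissible W U
  admissible-adjoin-R⁻ {U = U} {z = z} {W₀ = W₀} {W = W} {X = X} U-stable Uz R⊆W silent X⊆W W∖R⊆X (knotFree , sinks) =
    knotFree′ , sinks′
    where
    knotFree′ : KnotFreeIn D W
    knotFree′ K κ = knotFree K (knot-restrict X⊆W K⊆X κ)
      where
      K⊆X : K ⊆′ X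
      K⊆X k kk = W∖R⊆X k (KnotIn.sub κ k kk , λ r →
        knot-¬NoArcInto κ (knot-path κ kk (path-mono R⊆W (R⁻-path r))) silent)
    sinks′ : ∀ s → SinkIn D W s → U s
    sinks′ s sink = U-stable s (¬¬-map undecided-by-cases ¬¬-excluded-middle)
      where
      undecided-by-cases : Dec (R⁻ D W₀ z s) → U s
      undecided-by-cases (yes r) = subst U (sym (sink-R⁻ R⊆W sink r)) Uz
      undecided-by-cases (no ¬r) = sinks s (sink-restrict X⊆W (W∖R⊆X s (proj₁ sink , ¬r)) sink)

  sink-N⁺⊆ : ∀ {S : Subset (n D)} → SinkIn D (Full ∖ (_∈ S)) z → N⁺ D z ⊆′ (_∈ S)
  sink-N⁺⊆ {S = S} (_ , silent) c e = decidable-stable (c ∈? S) λ c∉S → silent c (tt , c∉S) e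

  feasible-drop-R⁻ : ∀ {S : Subset (n D)} → Stable U → Feasible D Full U (_∈ S) →
                     SinkIn D (Full ∖ (_∈ S)) z → Feasible D Full U ((_∈ S) ∖ R⁻ D Full z)
  feasible-drop-R⁻ {z = z} U-stable (_ , admissible) sz =
    (λ _ _ → tt) ,
    admissible-adjoin-R⁻ U-stable (proj₂ admissible z sz)
      (λ w r → tt , λ (_ , ¬r) → ¬r r)
      (λ c (_ , ∉S′) e → ∉S′ (sink-N⁺⊆ sz c e , λ r → proj₂ (proj₁ r) e))
      (λ w (_ , ∉S) → tt , λ (∈S , _) → ∉S ∈S)
      (λ w ((_ , ∉S′) , ¬r) → tt , λ ∈S → ∉S′ (∈S , ¬r))
      admissible

  -- Reachability is not decided; since the goal is ⊥, decidability of R⁻(z) may be assumed.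
  minimal-disjoint-R⁻ : ∀ {S : Subset (n D)} → Stable U → MinFeasible D Full U S →
                        SinkIn D (Full ∖ (_∈ S)) z → ∀ v → v ∈ S → ¬ R⁻ D Full z v
  minimal-disjoint-R⁻ {z = z} {S = S} U-stable (feasible , minimal) sz v v∈S r =
    ¬¬-decidable (R⁻ D Full z) λ R? →
      let T? = λ w → (w ∈? S) ×-dec ¬? (R? w)
          (T⊆ , ⊆T) = ∈-subset T?
          T-feasible = feasible-resp (⊆T , T⊆) (feasible-drop-R⁻ U-stable feasible sz)
      in proj₂ (T⊆ v (minimal (subset T?) T-feasible (λ {w} → proj₁ ∘ T⊆ w) v∈S)) r

  minimal-sink-R⁻ : ∀ {S : Subset (n D)} {x} → Stable U → MinFeasible D Full U S →
                    SinkIn D (Full ∖ (_∈ S)) x → SinkIn D (Full ∖ (_∈ S)) s → R⁻ D Full s x → x ≡ s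
  minimal-sink-R⁻ U-stable mf sx ss (_ , ε) = refl
  minimal-sink-R⁻ U-stable mf sx ss (_ , (_ , wy , e) ◅ p) =
    ⊥-elim (minimal-disjoint-R⁻ U-stable mf ss _ (sink-N⁺⊆ sx _ e) (wy , p))

  update-feasible : ∀ {S : Subset (n D)} {x} → Stable U → MinFeasible D Full U S →
                    SinkIn D (Full ∖ (_∈ S)) x →
                    Feasible D (updateV D Full x) (updateU D Full U x) ((_∈ S) ∖ N⁺ D x)
  update-feasible {U = U} {S = S} {x} U-stable mf@((_ , knotFree , sinks) , _) sx =
    S₀⊆V′ , knotFree′ , sinks′
    where
    S₀⊆V′ : ((_∈ S) ∖ N⁺ D x) ⊆′ updateV D Full x
    S₀⊆V′ w (w∈S , w∉N⁺) = tt , [ (λ (_ , e) → w∉N⁺ e) , minimal-disjoint-R⁻ U-stable mf sx w w∈S ]′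
    W″⊆X : updateV D Full x ∖ ((_∈ S) ∖ N⁺ D x) ⊆′ Full ∖ (_∈ S)
    W″⊆X w ((_ , w∉R) , w∉S₀) = tt , λ w∈S → w∉S₀ (w∈S , λ e → w∉R (inj₁ (tt , e)))
    closed : OutClosed (updateV D Full x ∖ ((_∈ S) ∖ N⁺ D x)) (Full ∖ (_∈ S))
    closed a b ((_ , a∉R) , _) (_ , b∉S) e =
      (tt , [ (λ (_ , e′) → b∉S (sink-N⁺⊆ sx b e′))
            , (λ r → a∉R (inj₂ (R⁻-step tt (λ e′ → a∉R (inj₁ (tt , e′))) e r))) ]′) ,
      (λ (b∈S , _) → b∉S b∈S)
    knotFree′ : KnotFreeIn D (updateV D Full x ∖ ((_∈ S) ∖ N⁺ D x))
    knotFree′ K κ = knotFree K (knot-extend W″⊆X closed κ)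
    sinks′ : ∀ s → SinkIn D (updateV D Full x ∖ ((_∈ S) ∖ N⁺ D x)) s → updateU D Full U x s
    sinks′ s sink@((s∈V′@(_ , s∉R) , _) , _) =
      s∈V′ , sinks s s-sink , λ (_ , r) →
        s∉R (inj₂ (subst (R⁻ D Full x) (minimal-sink-R⁻ U-stable mf sx s-sink r) (R⁻-refl tt)))
      where
      s-sink : SinkIn D (Full ∖ (_∈ S)) s
      s-sink = sink-closed W″⊆X closed sink

  update-lift : ∀ {S′ : VS} {x} → Stable U → U x →
                Feasible D (updateV D Full x) (updateU D Full U x) S′ →
                Feasible D Full U (N⁺ D x ∪ S′)
  update-lift U-stable Ux (S′⊆V′ , knotFree , sinks) =
    (λ _ _ → tt) ,
    admissible-adjoin-R⁻ U-stable Ux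
      (λ w r → tt , [ proj₂ (proj₁ r) , (λ w∈S′ → proj₂ (S′⊆V′ w w∈S′) (inj₂ r)) ]′)
      (λ c (_ , c∉) e → c∉ (inj₁ e))
      (λ w ((_ , w∉R) , w∉S′) → tt , [ (λ e → w∉R (inj₁ (tt , e))) , w∉S′ ]′)
      (λ w ((_ , w∉) , w∉R⁻) → (tt , [ (λ (_ , e) → w∉ (inj₁ e)) , w∉R⁻ ]′) , w∉ ∘ inj₂)
      (knotFree , λ s sink → proj₁ (proj₂ (sinks s sink)))

  update-minimal : ∀ {S : Subset (n D)} {x} → Stable U → MinFeasible D Full U S →
                   SinkIn D (Full ∖ (_∈ S)) x → (T′ : Subset (n D)) →
                   Feasible D (updateV D Full x) (updateU D Full U x) (_∈ T′) →
                   (_∈ T′) ⊆′ ((_∈ S) ∖ N⁺ D x) → ((_∈ S) ∖ N⁺ D x) ⊆′ (_∈ T′)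
  update-minimal {U = U} {S = S} {x} U-stable mf@((_ , _ , sinks) , minimal) sx T′ T′-feasible T′⊆S₀ v (v∈S , v∉N⁺) =
    [ ⊥-elim ∘ v∉N⁺ , id ]′ (T⊆ v (minimal (subset T?) T-feasible S⊇T v∈S))
    where
    T? : Decidable (N⁺ D x ∪ (_∈ T′))
    T? w = arc? D x w ⊎-dec (w ∈? T′)
    T⊆ : (_∈ subset T?) ⊆′ N⁺ D x ∪ (_∈ T′)
    T⊆ = proj₁ (∈-subset T?)
    T-feasible : Feasible D Full U (_∈ subset T?)
    T-feasible = feasible-resp (swap (∈-subset T?)) (update-lift U-stable (sinks x sx) T′-feasible)
    S⊇T : subset T? ⊆ S
    S⊇T {w} = [ sink-N⁺⊆ sx w , proj₁ ∘ T′⊆S₀ w ]′ ∘ T⊆ w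

proposition3 : (D : Digraph) (φ : Fin (n D) → Pot) (Smin : Subset (n D)) →
    MinFeasible D Full (Undecided φ) Smin →
    (x : Fin (n D)) → SinkIn D (Full ∖ (_∈ Smin)) x →
    (Σ (Subset (n D)) λ S′ →
        MinFeasible D (updateV D Full x) (updateU D Full (Undecided φ) x) S′ ×
        (∀ v → (v ∈ Smin) ⇔ (N⁺ D x v ⊎ v ∈ S′)))
    ×
    ((S′min : Subset (n D)) →
        MinFeasible D (updateV D Full x) (updateU D Full (Undecided φ) x) S′min →
        Feasible D Full (Undecided φ) (λ v → N⁺ D x v ⊎ v ∈ S′min))
proposition3 D φ Smin mf@((_ , _ , sinks) , _) x sx =
  (S′ , (S′-feasible , S′-minimal) , split) ,
  λ S′min mf′ → update-lift D U-stable (sinks x sx) (proj₁ mf′)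
  where
  U-stable : Stable (Undecided φ)
  U-stable v = decidable-stable (undecided? φ v)
  S′? : Decidable ((_∈ Smin) ∖ N⁺ D x)
  S′? w = (w ∈? Smin) ×-dec ¬? (arc? D x w)
  S′ : Subset (n D)
  S′ = subset S′?
  S′⊆ : (_∈ S′) ⊆′ (_∈ Smin) ∖ N⁺ D x
  S′⊆ = proj₁ (∈-subset S′?)
  S′-feasible : Feasible D (updateV D Full x) (updateU D Full (Undecided φ) x) (_∈ S′)
  S′-feasible = feasible-resp D (swap (∈-subset S′?)) (update-feasible D U-stable mf sx)
  S′-minimal : ∀ T′ → Feasible D (updateV D Full x) (updateU D Full (Undecided φ) x) (_∈ T′) →
               T′ ⊆ S′ → S′ ⊆ T′
  S′-minimal T′ T′-feasible T′⊆S′ {v} v∈S′ =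
    update-minimal D U-stable mf sx T′ T′-feasible (λ w → S′⊆ w ∘ T′⊆S′) v (S′⊆ v v∈S′)
  split : ∀ v → (v ∈ Smin) ⇔ (N⁺ D x v ⊎ v ∈ S′)
  split v = mk⇔ (λ v∈S → map₂ (λ v∉N⁺ → proj₂ (∈-subset S′?) v (v∈S , v∉N⁺)) (toSum (arc? D x v)))
                [ sink-N⁺⊆ D sx v , proj₁ ∘ S′⊆ v ]′
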